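{- Let $\lambda$ be a nonzero real number and $r\ge 0$ an integer. For every integer $n\ge 0$, $$(x)_{n,\lambda}=\frac{1}{2(n+r)_{r}}\bigg(\sum_{l=0}^{n}\binom{n+r}{l+r}(1)_{n-l,\lambda}A_{l+r,\lambda}^{(r)}(x)+A_{n+r,\lambda}^{(r)}(x)\bigg).$$
   Context: For nonzero real $\lambda$, the generalized falling factorials are $(x)_{0,\lambda}=1$ and $(x)_{n,\lambda}=x(x-\lambda)\cdots(x-(n-1)\lambda)$ for $n\ge1$. The degenerate exponential is $e_\lambda^x(t)=(1+\lambda t)^{x/\lambda}=\sum_{n\ge0}(x)_{n,\lambda}\frac{t^n}{n!}$, and $e_\lambda(t)=e_\lambda^1(t)$. The ordinary falling factorial is $(y)_0=1$, $(y)_r=y(y-1)\cdots(y-r+1)$ for $r\ge1$. For an integer $r\ge0$, the generalized degenerate Euler-Genocchi polynomials $A_{n,\lambda}^{(r)}(x)$ are defined by the generating function $\frac{2t^{r}}{e_{\lambda}(t)+1}e_{\lambda}^{x}(t)=\sum_{n=0}^{\infty}A_{n,\lambda}^{(r)}(x)\frac{t^{n}}{n!}$.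
   Formalization: The parameter λ and the variable x range over the rationals rather than the reals. -}

module Defs where

open import Data.Nat as ℕ using (ℕ; zero; suc; _∸_; _!; _≤ᵇ_)
import Data.Nat.Properties as ℕP
open import Data.Integer using (+_)
open import Data.Rational using (ℚ; 0ℚ; 1ℚ; _+_; _*_; _-_; _/_)
open import Data.List using (List; []; _∷_; _++_; [_])
open import Data.Bool using (if_then_else_)
open import Relation.Binary.PropositionalEquality using (_≡_; refl; sym; subst)

ℕ→ℚ : ℕ → ℚ
ℕ→ℚ n = + n / 1

fallλ : ℚ → ℚ → ℕ → ℚ
fallλ h x zero    = 1ℚ
fallλ h x (suc n) = fallλ h x n * (x - ℕ→ℚ n * h)

ff : ℕ → ℕ → ℕ
ff y zero    = 1
ff y (suc r) = y ℕ.* ff (y ∸ 1) r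

ff-nz′ : ∀ n r → ℕ.NonZero (ff (n ℕ.+ r) r)
ff-nz′ n zero = _
ff-nz′ n (suc r) =
  let eq : n ℕ.+ suc r ∸ 1 ≡ n ℕ.+ r
      eq = subst (λ k → k ∸ 1 ≡ n ℕ.+ r) (sym (ℕP.+-suc n r)) refl
      instance
        _ = subst (λ k → ℕ.NonZero (ff k r)) (sym eq) (ff-nz′ n r)
        _ : ℕ.NonZero (n ℕ.+ suc r)
        _ = subst ℕ.NonZero (sym (ℕP.+-suc n r)) _
  in ℕP.m*n≢0 (n ℕ.+ suc r) (ff (n ℕ.+ suc r ∸ 1) r)

ff-nz : ∀ n r → ℕ.NonZero (2 ℕ.* ff (n ℕ.+ r) r)
ff-nz n r = let instance _ = ff-nz′ n r in ℕP.m*n≢0 2 (ff (n ℕ.+ r) r)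

sumTo : ℕ → (ℕ → ℚ) → ℚ
sumTo zero    f = f 0
sumTo (suc n) f = sumTo n f + f (suc n)

invFact : ℕ → ℚ
invFact n = let instance _ = ℕP._!≢0 n in (+ 1) / (n !)

-- Formal power series are represented by their ordinary coefficient
-- sequences ℕ → ℚ.  Ordinary coefficients of e_h^x(t) = Σ (x)_{n,h} t^n / n!.
expλ : ℚ → ℚ → ℕ → ℚ
expλ h x n = fallλ h x n * invFact n

nth : List ℚ → ℕ → ℚ
nth []       _       = 0ℚ
nth (a ∷ as) zero    = a
nth (a ∷ as) (suc k) = nth as k

-- Power series division N / D, given d0inv = (D 0)⁻¹.
-- quotPrefix n = [Q_0, …, Q_n] where Q = N / D, i.e. the unique series
-- with D·Q = N, computed by the standard recursion
--   Q_m = (N_m - Σ_{k=1}^{m} D_k Q_{m-k}) · (D_0)⁻¹.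
quotPrefix : (N D : ℕ → ℚ) → ℚ → ℕ → List ℚ
quotPrefix N D d0inv zero    = [ N 0 * d0inv ]
quotPrefix N D d0inv (suc n) =
  let p = quotPrefix N D d0inv n in
  p ++ [ (N (suc n) - sumTo n (λ j → nth p j * D (suc n ∸ j))) * d0inv ]

quotCoeff : (N D : ℕ → ℚ) → ℚ → ℕ → ℚ
quotCoeff N D d0inv n = nth (quotPrefix N D d0inv n) n

-- numerator series 2 t^r e_h^x(t)
numSeries : ℚ → ℕ → ℚ → ℕ → ℚ
numSeries h r x n = if r ≤ᵇ n then ℕ→ℚ 2 * expλ h x (n ∸ r) else 0ℚ

-- denominator series e_h(t) + 1
denSeries : ℚ → ℕ → ℚ
denSeries h zero    = expλ h 1ℚ 0 + 1ℚ
denSeries h (suc n) = expλ h 1ℚ (suc n)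

-- generalized degenerate Euler–Genocchi polynomial A^{(r)}_{n,h}(x):
--   2 t^r e_h^x(t) / (e_h(t) + 1) = Σ_n A^{(r)}_{n,h}(x) t^n / n!
-- (the constant term of e_h(t) + 1 is 2, with inverse 1/2)
A : ℚ → ℕ → ℕ → ℚ → ℚ
A h r n x = ℕ→ℚ (n !) * quotCoeff (numSeries h r x) (denSeries h) (+ 1 / 2) n

-- Clearing the denominator, 2 tʳ e_λˣ(t) = (e_λ(t) + 1) Σ_m A⁽ʳ⁾_{m,λ}(x) tᵐ/m!.
-- Since A⁽ʳ⁾_{j,λ}(x) = 0 for j < r, comparing coefficients of t^{n+r} gives
--   2 (x)_{n,λ}/n! = Σ_{l ≤ n} A⁽ʳ⁾_{l+r,λ}(x)/(l+r)! · (1)_{n-l,λ}/(n-l)!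
--                    + A⁽ʳ⁾_{n+r,λ}(x)/(n+r)!,
-- the extra last term coming from the constant 1 in e_λ(t) + 1.  Multiplying by
-- (n+r)! = (n+r)_r n! turns the weights into binomial coefficients.
module Submission where

open import Defs
open import Data.Nat using (ℕ; zero; suc; _+_; _∸_; _!; _≤_; _<_; _≤ᵇ_; z≤n; s≤s; NonZero)
  renaming (_*_ to _*ℕ_)
import Data.Nat.Properties as ℕP
open import Data.Nat.Combinatorics using (_C_; nCk≡n!/k![n-k]!; k![n∸k]!∣n!)
open import Data.Nat.DivMod using (m/n*n≡m)
open import Data.Integer using (+_)
import Data.Integer.Properties as ℤP
open import Data.Rational using (ℚ; 0ℚ; 1ℚ; _/_; _*_; _-_; toℚᵘ) renaming (_+_ to _+ℚ_)
import Data.Rational.Properties as ℚP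
import Data.Rational.Unnormalised as ℚᵘ
import Data.Rational.Unnormalised.Properties as ℚᵘP
open import Data.Rational.Solver using (module +-*-Solver)
open import Data.List using ([]; _∷_; _++_; [_]; length)
open import Data.List.Properties using (length-++)
open import Data.Bool using (true; false)
open import Data.Sum using (inj₁; inj₂)
open import Relation.Nullary using (contradiction)
open import Relation.Nullary.Reflects using (ofʸ; ofⁿ)
open import Relation.Binary.PropositionalEquality
  using (_≡_; _≢_; refl; sym; trans; cong; cong₂; module ≡-Reasoning)

open +-*-Solver

-- ℕ→ℚ n and + 1 / suc k are definitionally fromℚᵘ (mkℚᵘ (+ n) 0) and fromℚᵘ (mkℚᵘ (+ 1) k),
-- and the latter is definitionally fromℚᵘ (ℚᵘ.1/ mkℚᵘ (+ suc k) 0).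
toℚᵘ-ℕ→ℚ : ∀ n → toℚᵘ (ℕ→ℚ n) ℚᵘ.≃ ℚᵘ.mkℚᵘ (+ n) 0
toℚᵘ-ℕ→ℚ n = ℚP.toℚᵘ-fromℚᵘ (ℚᵘ.mkℚᵘ (+ n) 0)

ℕ→ℚ-* : ∀ m n → ℕ→ℚ (m *ℕ n) ≡ ℕ→ℚ m * ℕ→ℚ n
ℕ→ℚ-* m n = ℚP.toℚᵘ-injective (begin
  toℚᵘ (ℕ→ℚ (m *ℕ n))
    ≈⟨ toℚᵘ-ℕ→ℚ (m *ℕ n) ⟩
  ℚᵘ.mkℚᵘ (+ (m *ℕ n)) 0
    ≡⟨ cong (λ i → ℚᵘ.mkℚᵘ i 0) (ℤP.pos-* m n) ⟩
  ℚᵘ.mkℚᵘ (+ m) 0 ℚᵘ.* ℚᵘ.mkℚᵘ (+ n) 0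
    ≈⟨ ℚᵘP.*-cong (toℚᵘ-ℕ→ℚ m) (toℚᵘ-ℕ→ℚ n) ⟨
  toℚᵘ (ℕ→ℚ m) ℚᵘ.* toℚᵘ (ℕ→ℚ n)
    ≈⟨ ℚP.toℚᵘ-homo-* (ℕ→ℚ m) (ℕ→ℚ n) ⟨
  toℚᵘ (ℕ→ℚ m * ℕ→ℚ n)
    ∎)
  where open ℚᵘP.≃-Reasoning

1/n*n≡1 : ∀ n .{{_ : NonZero n}} → (+ 1 / n) * ℕ→ℚ n ≡ 1ℚ
1/n*n≡1 n@(suc k) = ℚP.toℚᵘ-injective (begin
  toℚᵘ ((+ 1 / n) * ℕ→ℚ n)
    ≈⟨ ℚP.toℚᵘ-homo-* (+ 1 / n) (ℕ→ℚ n) ⟩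
  toℚᵘ (+ 1 / n) ℚᵘ.* toℚᵘ (ℕ→ℚ n)
    ≈⟨ ℚᵘP.*-cong (ℚP.toℚᵘ-fromℚᵘ (ℚᵘ.mkℚᵘ (+ 1) k)) (toℚᵘ-ℕ→ℚ n) ⟩
  ℚᵘ.1/ ℚᵘ.mkℚᵘ (+ n) 0 ℚᵘ.* ℚᵘ.mkℚᵘ (+ n) 0
    ≈⟨ ℚᵘP.*-inverseˡ (ℚᵘ.mkℚᵘ (+ n) 0) ⟩
  toℚᵘ 1ℚ
    ∎)
  where open ℚᵘP.≃-Reasoning

invFact*n!≡1 : ∀ n → invFact n * ℕ→ℚ (n !) ≡ 1ℚ
invFact*n!≡1 n = let instance _ = ℕP._!≢0 n in 1/n*n≡1 (n !)

nCk*[k!*[n∸k]!]≡n! : ∀ {n k} → k ≤ n → (n C k) *ℕ (k ! *ℕ (n ∸ k) !) ≡ n !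
nCk*[k!*[n∸k]!]≡n! {n} {k} k≤n =
  let instance _ = ℕP.m*n≢0 (k !) ((n ∸ k) !) {{ℕP._!≢0 k}} {{ℕP._!≢0 (n ∸ k)}} in
  trans (cong (_*ℕ (k ! *ℕ (n ∸ k) !)) (nCk≡n!/k![n-k]! k≤n)) (m/n*n≡m (k![n∸k]!∣n! k≤n))

ff*[m∸r]!≡m! : ∀ {m r} → r ≤ m → ff m r *ℕ (m ∸ r) ! ≡ m !
ff*[m∸r]!≡m! {m} {zero}  _         = ℕP.*-identityˡ (m !)
ff*[m∸r]!≡m! {suc m} {suc r} (s≤s r≤m) =
  trans (ℕP.*-assoc (suc m) (ff m r) ((m ∸ r) !)) (cong (suc m *ℕ_) (ff*[m∸r]!≡m! r≤m))

[n+r]∸[l+r]≡n∸l : ∀ n l r → (n + r) ∸ (l + r) ≡ n ∸ l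
[n+r]∸[l+r]≡n∸l n l r =
  trans (cong₂ _∸_ (ℕP.+-comm n r) (ℕP.+-comm l r)) (ℕP.[m+n]∸[m+o]≡n∸o r n l)

sumTo-cong : ∀ n {f g : ℕ → ℚ} → (∀ j → j ≤ n → f j ≡ g j) → sumTo n f ≡ sumTo n g
sumTo-cong zero    f≗g = f≗g 0 z≤n
sumTo-cong (suc n) f≗g =
  cong₂ _+ℚ_ (sumTo-cong n (λ j j≤n → f≗g j (ℕP.m≤n⇒m≤1+n j≤n))) (f≗g (suc n) ℕP.≤-refl)

*-distribˡ-sumTo : ∀ n c f → c * sumTo n f ≡ sumTo n (λ j → c * f j)
*-distribˡ-sumTo zero    c f = refl
*-distribˡ-sumTo (suc n) c f =
  trans (ℚP.*-distribˡ-+ c (sumTo n f) (f (suc n))) (cong (_+ℚ c * f (suc n)) (*-distribˡ-sumTo n c f))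

sumTo-last : ∀ n {f : ℕ → ℚ} → (∀ j → j < n → f j ≡ 0ℚ) → sumTo n f ≡ f n
sumTo-last zero    _   = refl
sumTo-last (suc n) {f} f≗0 =
  trans (cong (_+ℚ f (suc n)) (trans (sumTo-last n (λ j j<n → f≗0 j (ℕP.m<n⇒m<1+n j<n))) (f≗0 n ℕP.≤-refl)))
        (ℚP.+-identityˡ (f (suc n)))

sumTo-zero : ∀ n {f : ℕ → ℚ} → (∀ j → j ≤ n → f j ≡ 0ℚ) → sumTo n f ≡ 0ℚ
sumTo-zero n f≗0 = trans (sumTo-last n (λ j j<n → f≗0 j (ℕP.<⇒≤ j<n))) (f≗0 n ℕP.≤-refl)

sumTo-dropInitial : ∀ r n {f : ℕ → ℚ} → (∀ j → j < r → f j ≡ 0ℚ) →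
                    sumTo (n + r) f ≡ sumTo n (λ l → f (l + r))
sumTo-dropInitial r zero    f≗0 = sumTo-last r f≗0
sumTo-dropInitial r (suc n) {f} f≗0 = cong (_+ℚ f (suc (n + r))) (sumTo-dropInitial r n f≗0)

nth-++ˡ : ∀ p q {j} → j < length p → nth (p ++ q) j ≡ nth p j
nth-++ˡ (a ∷ p) q {zero}  _         = refl
nth-++ˡ (a ∷ p) q {suc j} (s≤s j<p) = nth-++ˡ p q j<p

nth-length-++ : ∀ p a → nth (p ++ [ a ]) (length p) ≡ a
nth-length-++ []      a = refl
nth-length-++ (b ∷ p) a = nth-length-++ p a

module PowerSeriesDivision (N D : ℕ → ℚ) (d₀⁻¹ : ℚ) where

  Q : ℕ → ℚ
  Q = quotCoeff N D d₀⁻¹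

  length-quotPrefix : ∀ n → length (quotPrefix N D d₀⁻¹ n) ≡ suc n
  length-quotPrefix zero    = refl
  length-quotPrefix (suc n) =
    trans (length-++ (quotPrefix N D d₀⁻¹ n))
          (trans (cong (_+ 1) (length-quotPrefix n)) (ℕP.+-comm (suc n) 1))

  nth-quotPrefix : ∀ n {j} → j ≤ n → nth (quotPrefix N D d₀⁻¹ n) j ≡ Q j
  nth-quotPrefix zero    z≤n = refl
  nth-quotPrefix (suc n) j≤1+n with ℕP.m≤n⇒m<n∨m≡n j≤1+n
  ... | inj₂ refl      = refl
  ... | inj₁ (s≤s j≤n) = trans (nth-++ˡ (quotPrefix N D d₀⁻¹ n) _ j<length) (nth-quotPrefix n j≤n)
    where j<length = ℕP.≤-trans (s≤s j≤n) (ℕP.≤-reflexive (sym (length-quotPrefix n)))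

  Q-suc : ∀ k → Q (suc k) ≡ (N (suc k) - sumTo k (λ j → Q j * D (suc k ∸ j))) * d₀⁻¹
  Q-suc k = begin
    nth (p ++ [ new ]) (suc k)
      ≡⟨ cong (nth (p ++ [ new ])) (sym (length-quotPrefix k)) ⟩
    nth (p ++ [ new ]) (length p)
      ≡⟨ nth-length-++ p new ⟩
    new
      ≡⟨ cong (λ s → (N (suc k) - s) * d₀⁻¹) (sumTo-cong k prefix≗Q) ⟩
    (N (suc k) - sumTo k (λ j → Q j * D (suc k ∸ j))) * d₀⁻¹
      ∎
    where
    open ≡-Reasoning
    p   = quotPrefix N D d₀⁻¹ k
    new = (N (suc k) - sumTo k (λ j → nth p j * D (suc k ∸ j))) * d₀⁻¹
    prefix≗Q : ∀ j → j ≤ k → nth p j * D (suc k ∸ j) ≡ Q j * D (suc k ∸ j)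
    prefix≗Q j j≤k = cong (_* D (suc k ∸ j)) (nth-quotPrefix k j≤k)

  Q*D≡N : d₀⁻¹ * D 0 ≡ 1ℚ → ∀ m → sumTo m (λ j → Q j * D (m ∸ j)) ≡ N m
  Q*D≡N d₀⁻¹*d₀≡1 zero = begin
    N 0 * d₀⁻¹ * D 0    ≡⟨ ℚP.*-assoc (N 0) d₀⁻¹ (D 0) ⟩
    N 0 * (d₀⁻¹ * D 0)  ≡⟨ cong (N 0 *_) d₀⁻¹*d₀≡1 ⟩
    N 0 * 1ℚ            ≡⟨ ℚP.*-identityʳ (N 0) ⟩
    N 0                 ∎
    where open ≡-Reasoning
  Q*D≡N d₀⁻¹*d₀≡1 (suc k) = begin
    S +ℚ Q (suc k) * D (k ∸ k)
      ≡⟨ cong₂ (λ q i → S +ℚ q * D i) (Q-suc k) (ℕP.n∸n≡0 k) ⟩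
    S +ℚ (N (suc k) - S) * d₀⁻¹ * D 0
      ≡⟨ cong (S +ℚ_) (ℚP.*-assoc (N (suc k) - S) d₀⁻¹ (D 0)) ⟩
    S +ℚ (N (suc k) - S) * (d₀⁻¹ * D 0)
      ≡⟨ cong (λ u → S +ℚ (N (suc k) - S) * u) d₀⁻¹*d₀≡1 ⟩
    S +ℚ (N (suc k) - S) * 1ℚ
      ≡⟨ solve 2 (λ s n → s :+ (n :- s) :* con 1ℚ := n) refl S (N (suc k)) ⟩
    N (suc k)
      ∎
    where
    open ≡-Reasoning
    S = sumTo k (λ j → Q j * D (suc k ∸ j))

  Q-vanish : ∀ m → (∀ j → j ≤ m → N j ≡ 0ℚ) → ∀ j → j ≤ m → Q j ≡ 0ℚ
  Q-vanish zero    N≗0 zero z≤n = trans (cong (_* d₀⁻¹) (N≗0 0 z≤n)) (ℚP.*-zeroˡ d₀⁻¹)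
  Q-vanish (suc k) N≗0 = Q≗0
    where
    open ≡-Reasoning
    Q≗0↾k : ∀ i → i ≤ k → Q i ≡ 0ℚ
    Q≗0↾k = Q-vanish k (λ i i≤k → N≗0 i (ℕP.m≤n⇒m≤1+n i≤k))
    terms≡0 : ∀ i → i ≤ k → Q i * D (suc k ∸ i) ≡ 0ℚ
    terms≡0 i i≤k = trans (cong (_* D (suc k ∸ i)) (Q≗0↾k i i≤k)) (ℚP.*-zeroˡ (D (suc k ∸ i)))
    Q≗0 : ∀ j → j ≤ suc k → Q j ≡ 0ℚ
    Q≗0 j j≤1+k with ℕP.m≤n⇒m<n∨m≡n j≤1+k
    ... | inj₁ (s≤s j≤k) = Q≗0↾k j j≤k
    ... | inj₂ refl      = begin
      Q (suc k)
        ≡⟨ Q-suc k ⟩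
      (N (suc k) - sumTo k (λ i → Q i * D (suc k ∸ i))) * d₀⁻¹
        ≡⟨ cong₂ (λ a s → (a - s) * d₀⁻¹) (N≗0 (suc k) ℕP.≤-refl) (sumTo-zero k terms≡0) ⟩
      (0ℚ - 0ℚ) * d₀⁻¹
        ≡⟨ ℚP.*-zeroˡ d₀⁻¹ ⟩
      0ℚ
        ∎

numSeries-< : ∀ h r x {m} → m < r → numSeries h r x m ≡ 0ℚ
numSeries-< h r x {m} m<r with r ≤ᵇ m | ℕP.≤ᵇ-reflects-≤ r m
... | false | ofⁿ _   = refl
... | true  | ofʸ r≤m = contradiction r≤m (ℕP.<⇒≱ m<r)

numSeries-+ : ∀ h r x n → numSeries h r x (n + r) ≡ ℕ→ℚ 2 * expλ h x n
numSeries-+ h r x n with r ≤ᵇ n + r | ℕP.≤ᵇ-reflects-≤ r (n + r)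
... | true  | ofʸ _     = cong (λ k → ℕ→ℚ 2 * expλ h x k) (ℕP.m+n∸n≡m n r)
... | false | ofⁿ r≰n+r = contradiction (ℕP.m≤n+m r n) r≰n+r

denSeries-pos : ∀ h {k} → 0 < k → denSeries h k ≡ expλ h 1ℚ k
denSeries-pos h {suc k} _ = refl

*-denSeries₀ : ∀ h a → a * denSeries h 0 ≡ a * expλ h 1ℚ 0 +ℚ a
*-denSeries₀ h a =
  trans (ℚP.*-distribˡ-+ a (expλ h 1ℚ 0) 1ℚ) (cong (a * expλ h 1ℚ 0 +ℚ_) (ℚP.*-identityʳ a))

sumTo-*-denSeries : ∀ h n (f : ℕ → ℚ) → sumTo n (λ l → f l * denSeries h (n ∸ l)) ≡
                                        sumTo n (λ l → f l * expλ h 1ℚ (n ∸ l)) +ℚ f n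
sumTo-*-denSeries h zero    f = *-denSeries₀ h (f 0)
sumTo-*-denSeries h (suc n) f = begin
  sumTo n (λ l → f l * D (suc n ∸ l)) +ℚ f (suc n) * D (n ∸ n)
    ≡⟨ cong₂ _+ℚ_ (sumTo-cong n D≗E) (cong (λ i → f (suc n) * D i) (ℕP.n∸n≡0 n)) ⟩
  S +ℚ f (suc n) * D 0
    ≡⟨ cong (S +ℚ_) (*-denSeries₀ h (f (suc n))) ⟩
  S +ℚ (f (suc n) * E 0 +ℚ f (suc n))
    ≡⟨ ℚP.+-assoc S (f (suc n) * E 0) (f (suc n)) ⟨
  S +ℚ f (suc n) * E 0 +ℚ f (suc n)
    ≡⟨ cong (λ i → S +ℚ f (suc n) * E i +ℚ f (suc n)) (ℕP.n∸n≡0 n) ⟨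
  S +ℚ f (suc n) * E (n ∸ n) +ℚ f (suc n)
    ∎
  where
  open ≡-Reasoning
  D = denSeries h
  E = expλ h 1ℚ
  S = sumTo n (λ l → f l * E (suc n ∸ l))
  D≗E : ∀ l → l ≤ n → f l * D (suc n ∸ l) ≡ f l * E (suc n ∸ l)
  D≗E l l≤n = cong (f l *_) (denSeries-pos h (ℕP.m<n⇒0<n∸m (s≤s l≤n)))

module EulerGenocchi (h x : ℚ) (r : ℕ) where

  open PowerSeriesDivision (numSeries h r x) (denSeries h) (+ 1 / 2)

  Q≗0-below-r : ∀ j → j < r → Q j ≡ 0ℚ
  Q≗0-below-r j j<r = Q-vanish j (λ i i≤j → numSeries-< h r x (ℕP.≤-<-trans i≤j j<r)) j ℕP.≤-refl

  coefficient-identity : ∀ n → sumTo n (λ l → Q (l + r) * expλ h 1ℚ (n ∸ l)) +ℚ Q (n + r) ≡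
                               ℕ→ℚ 2 * expλ h x n
  coefficient-identity n = begin
    sumTo n (λ l → Q (l + r) * expλ h 1ℚ (n ∸ l)) +ℚ Q (n + r)
      ≡⟨ sumTo-*-denSeries h n (λ l → Q (l + r)) ⟨
    sumTo n (λ l → Q (l + r) * denSeries h (n ∸ l))
      ≡⟨ sumTo-cong n (λ l _ → cong (λ k → Q (l + r) * denSeries h k) ([n+r]∸[l+r]≡n∸l n l r)) ⟨
    sumTo n (λ l → Q (l + r) * denSeries h (n + r ∸ (l + r)))
      ≡⟨ sumTo-dropInitial r n terms≡0 ⟨
    sumTo (n + r) (λ j → Q j * denSeries h (n + r ∸ j))
      ≡⟨ Q*D≡N refl (n + r) ⟩
    numSeries h r x (n + r)
      ≡⟨ numSeries-+ h r x n ⟩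
    ℕ→ℚ 2 * expλ h x n
      ∎
    where
    open ≡-Reasoning
    terms≡0 : ∀ j → j < r → Q j * denSeries h (n + r ∸ j) ≡ 0ℚ
    terms≡0 j j<r =
      trans (cong (_* denSeries h (n + r ∸ j)) (Q≗0-below-r j j<r)) (ℚP.*-zeroˡ (denSeries h (n + r ∸ j)))

  -- From here on A h r m x appears in its unfolded form ℕ→ℚ (m !) * Q m.
  weight-as-binomial : ∀ n l → l ≤ n →
    ℕ→ℚ ((n + r) !) * (Q (l + r) * expλ h 1ℚ (n ∸ l)) ≡
    ℕ→ℚ ((n + r) C (l + r)) * fallλ h 1ℚ (n ∸ l) * A h r (l + r) x
  weight-as-binomial n l l≤n = begin
    ℕ→ℚ ((n + r) !) * (q * (f * i))
      ≡⟨ cong (_* (q * (f * i))) [n+r]!≡c*[a*b] ⟩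
    c * (a * b) * (q * (f * i))
      ≡⟨ solve 6 (λ c a b q f i → c :* (a :* b) :* (q :* (f :* i)) := c :* f :* (a :* q) :* (i :* b)) refl c a b q f i ⟩
    c * f * (a * q) * (i * b)
      ≡⟨ cong (c * f * (a * q) *_) (invFact*n!≡1 (n ∸ l)) ⟩
    c * f * (a * q) * 1ℚ
      ≡⟨ ℚP.*-identityʳ (c * f * (a * q)) ⟩
    c * f * A h r (l + r) x
      ∎
    where
    open ≡-Reasoning
    q = Q (l + r)
    f = fallλ h 1ℚ (n ∸ l)
    i = invFact (n ∸ l)
    c = ℕ→ℚ ((n + r) C (l + r))
    a = ℕ→ℚ ((l + r) !)
    b = ℕ→ℚ ((n ∸ l) !)
    [n+r]!≡c*[a*b] : ℕ→ℚ ((n + r) !) ≡ c * (a * b)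
    [n+r]!≡c*[a*b] = begin
      ℕ→ℚ ((n + r) !)
        ≡⟨ cong ℕ→ℚ (nCk*[k!*[n∸k]!]≡n! (ℕP.+-monoˡ-≤ r l≤n)) ⟨
      ℕ→ℚ (((n + r) C (l + r)) *ℕ ((l + r) ! *ℕ (n + r ∸ (l + r)) !))
        ≡⟨ cong (λ k → ℕ→ℚ (((n + r) C (l + r)) *ℕ ((l + r) ! *ℕ k !))) ([n+r]∸[l+r]≡n∸l n l r) ⟩
      ℕ→ℚ (((n + r) C (l + r)) *ℕ ((l + r) ! *ℕ (n ∸ l) !))
        ≡⟨ ℕ→ℚ-* ((n + r) C (l + r)) ((l + r) ! *ℕ (n ∸ l) !) ⟩
      c * ℕ→ℚ ((l + r) ! *ℕ (n ∸ l) !)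
        ≡⟨ cong (c *_) (ℕ→ℚ-* ((l + r) !) ((n ∸ l) !)) ⟩
      c * (a * b)
        ∎

  [n+r]!*2expλ≡2ff*fallλ : ∀ n →
    ℕ→ℚ ((n + r) !) * (ℕ→ℚ 2 * expλ h x n) ≡ ℕ→ℚ (2 *ℕ ff (n + r) r) * fallλ h x n
  [n+r]!*2expλ≡2ff*fallλ n = begin
    ℕ→ℚ ((n + r) !) * (t * (X * i))
      ≡⟨ cong (_* (t * (X * i))) [n+r]!≡p*m ⟩
    p * m * (t * (X * i))
      ≡⟨ solve 5 (λ p m t X i → p :* m :* (t :* (X :* i)) := t :* p :* X :* (i :* m)) refl p m t X i ⟩
    t * p * X * (i * m)
      ≡⟨ cong (t * p * X *_) (invFact*n!≡1 n) ⟩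
    t * p * X * 1ℚ
      ≡⟨ ℚP.*-identityʳ (t * p * X) ⟩
    t * p * X
      ≡⟨ cong (_* X) (ℕ→ℚ-* 2 (ff (n + r) r)) ⟨
    ℕ→ℚ (2 *ℕ ff (n + r) r) * X
      ∎
    where
    open ≡-Reasoning
    t = ℕ→ℚ 2
    X = fallλ h x n
    i = invFact n
    p = ℕ→ℚ (ff (n + r) r)
    m = ℕ→ℚ (n !)
    [n+r]!≡p*m : ℕ→ℚ ((n + r) !) ≡ p * m
    [n+r]!≡p*m = begin
      ℕ→ℚ ((n + r) !)                     ≡⟨ cong ℕ→ℚ (ff*[m∸r]!≡m! (ℕP.m≤n+m r n)) ⟨
      ℕ→ℚ (ff (n + r) r *ℕ (n + r ∸ r) !) ≡⟨ cong (λ k → ℕ→ℚ (ff (n + r) r *ℕ k !)) (ℕP.m+n∸n≡m n r) ⟩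
      ℕ→ℚ (ff (n + r) r *ℕ n !)           ≡⟨ ℕ→ℚ-* (ff (n + r) r) (n !) ⟩
      p * m                               ∎

  binomial-sum-identity : ∀ n →
    sumTo n (λ l → ℕ→ℚ ((n + r) C (l + r)) * fallλ h 1ℚ (n ∸ l) * A h r (l + r) x) +ℚ A h r (n + r) x ≡
    ℕ→ℚ (2 *ℕ ff (n + r) r) * fallλ h x n
  binomial-sum-identity n = begin
    sumTo n (λ l → ℕ→ℚ ((n + r) C (l + r)) * fallλ h 1ℚ (n ∸ l) * A h r (l + r) x) +ℚ F * Q (n + r)
      ≡⟨ cong (_+ℚ F * Q (n + r)) (sumTo-cong n (weight-as-binomial n)) ⟨
    sumTo n (λ l → F * W l) +ℚ F * Q (n + r)
      ≡⟨ cong (_+ℚ F * Q (n + r)) (*-distribˡ-sumTo n F W) ⟨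
    F * sumTo n W +ℚ F * Q (n + r)
      ≡⟨ ℚP.*-distribˡ-+ F (sumTo n W) (Q (n + r)) ⟨
    F * (sumTo n W +ℚ Q (n + r))
      ≡⟨ cong (F *_) (coefficient-identity n) ⟩
    F * (ℕ→ℚ 2 * expλ h x n)
      ≡⟨ [n+r]!*2expλ≡2ff*fallλ n ⟩
    ℕ→ℚ (2 *ℕ ff (n + r) r) * fallλ h x n
      ∎
    where
    open ≡-Reasoning
    F = ℕ→ℚ ((n + r) !)
    W = λ l → Q (l + r) * expλ h 1ℚ (n ∸ l)

-- The identity holds for h = 0 as well (there fallλ 0 x n = xⁿ).
theorem1 : (h x : ℚ) → h ≢ 0ℚ → (r n : ℕ) →
    fallλ h x n ≡
      ((+ 1 / (2 *ℕ ff (n + r) r)) {{ff-nz n r}}) *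
        (sumTo n (λ l → ℕ→ℚ ((n + r) C (l + r)) * fallλ h 1ℚ (n ∸ l) * A h r (l + r) x)
          +ℚ A h r (n + r) x)
theorem1 h x _ r n = sym (begin
  [1/K] * (sumTo n (λ l → ℕ→ℚ ((n + r) C (l + r)) * fallλ h 1ℚ (n ∸ l) * A h r (l + r) x) +ℚ A h r (n + r) x)
    ≡⟨ cong ([1/K] *_) (EulerGenocchi.binomial-sum-identity h x r n) ⟩
  [1/K] * (ℕ→ℚ K * fallλ h x n)   ≡⟨ ℚP.*-assoc [1/K] (ℕ→ℚ K) (fallλ h x n) ⟨
  [1/K] * ℕ→ℚ K * fallλ h x n     ≡⟨ cong (_* fallλ h x n) (1/n*n≡1 K) ⟩
  1ℚ * fallλ h x n                ≡⟨ ℚP.*-identityˡ (fallλ h x n) ⟩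
  fallλ h x n                     ∎)
  where
  open ≡-Reasoning
  K = 2 *ℕ ff (n + r) r
  instance _ = ff-nz n r
  [1/K] = + 1 / K
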